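{- Let $G$ be a finite bipartite graph and let $\{C,H\}$ be a decomposition of $G$. Suppose that all vertices in $V(C)\cap V(H)$ belong to the same bipartite class of $G$ and are all 2-layered in $G$. Then every vertex that is rare in $C$, and every vertex that is rare in $H$, is rare in $G$.
   Context: A stable set of a graph is a set of pairwise non-adjacent vertices; it is maximal if no further vertex can be added while keeping it stable. A vertex $x$ of a finite graph $K$ is rare in $K$ if $x$ lies in at most half of the maximal stable sets of $K$. A decomposition of a graph $G$ is a set of pairwise edge-disjoint subgraphs $H_1,\dots,H_n$ of $G$ whose union (of vertex sets and of edge sets) is $G$. A pendant vertex is a vertex of degree $1$ in $G$. A vertex $v\in V(G)$ is 2-layered (in $G$) if every vertex in $N_G(v)$, the set of neighbours of $v$ in $G$, is adjacent to some pendant vertex of $G$. -}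

module Defs where

open import Data.Nat using (ℕ; zero; suc; _*_; _≤_)
open import Data.Bool using (Bool; true; false; _∧_; _∨_; not; T)
open import Data.Fin using (Fin)
open import Data.Vec using (Vec; []; _∷_; lookup)
open import Data.List using (List; []; _∷_; map; _++_; length; filterᵇ; allFin)
open import Data.Bool.ListAction using (all; any)
open import Data.Product using (Σ; ∃; _×_; _,_)
open import Relation.Binary.PropositionalEquality using (_≡_; _≢_)

-- A finite simple graph whose vertex set is a subset of Fin n
-- (Fin n is an ambient universe; V says which elements are vertices).
record Graph (n : ℕ) : Set where
  field
    V      : Fin n → Bool
    E      : Fin n → Fin n → Bool
    E-sym  : ∀ u v → E u v ≡ E v u
    E-irr  : ∀ v → E v v ≡ false
    E-V    : ∀ u v → E u v ≡ true → V u ≡ true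
open Graph public

Subset : ℕ → Set
Subset n = Vec Bool n

allSubsets : (n : ℕ) → List (Subset n)
allSubsets zero = [] ∷ []
allSubsets (suc n) = map (true ∷_) (allSubsets n) ++ map (false ∷_) (allSubsets n)

module _ {n : ℕ} (K : Graph n) where
  isStable : Subset n → Bool
  isStable S = all (λ u → not (lookup S u) ∨ V K u) (allFin n)
             ∧ all (λ u → all (λ v → not (lookup S u ∧ lookup S v ∧ E K u v)) (allFin n)) (allFin n)

  isMaximalStable : Subset n → Bool
  isMaximalStable S = isStable S
    ∧ all (λ v → not (V K v ∧ not (lookup S v)) ∨ any (λ u → lookup S u ∧ E K v u) (allFin n)) (allFin n)

  maximalStableSets : List (Subset n)
  maximalStableSets = filterᵇ isMaximalStable (allSubsets n)

  Rare : Fin n → Set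
  Rare x = (V K x ≡ true)
         × (2 * length (filterᵇ (λ S → lookup S x) maximalStableSets) ≤ length maximalStableSets)

  degree : Fin n → ℕ
  degree v = length (filterᵇ (E K v) (allFin n))

  Pendant : Fin n → Set
  Pendant v = degree v ≡ 1

  TwoLayered : Fin n → Set
  TwoLayered v = ∀ u → E K v u ≡ true → ∃ λ w → (E K u w ≡ true) × Pendant w

  IsBipartition : (Fin n → Bool) → Set
  IsBipartition c = ∀ u v → E K u v ≡ true → c u ≢ c v

  Bipartite : Set
  Bipartite = ∃ IsBipartition

record IsDecomposition {n : ℕ} (G C H : Graph n) : Set where
  field
    V-union   : ∀ v → V G v ≡ (V C v ∨ V H v)
    E-union   : ∀ u v → E G u v ≡ (E C u v ∨ E H u v)
    E-disjoint : ∀ u v → (E C u v ∧ E H u v) ≡ false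

module Submission where

-- Maximal stable sets of G correspond bijectively to pairs (A , B) of maximal stable sets of
-- C and H. Going down, a maximal stable set I of G is restricted to each part, a shared
-- vertex being kept in the C-part iff I contains none of its C-neighbours (likewise for H);
-- going up, A and B are glued by intersecting them on the shared vertices. The glued set is
-- stable because shared vertices lie in one bipartition class, and it is dominating because
-- a private vertex whose only dominator in A is a shared vertex outside the glued set has a
-- pendant neighbour, which A and B are both forced to contain. Hence G has m(C) m(H) maximal
-- stable sets, and those containing a vertex x of C number m_x(C) m(H) or m_x(C) m_x(H);
-- either way rarity of x in C passes to G.

open import Defs
open import Data.Bool using (Bool; true; false; _∧_; _∨_; not; if_then_else_)
import Data.Bool.Properties as Bool
open import Data.Bool.ListAction using (all; any)
open import Data.Empty using (⊥; ⊥-elim)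
open import Data.Fin using (Fin)
open import Data.List using (List; []; _∷_; map; _++_; length; filterᵇ; allFin)
open import Data.List.Membership.Propositional using (_∈_)
open import Data.List.Membership.Propositional.Properties using (∈-allFin; ∈-filter⁺)
open import Data.List.Properties using (length-filter)
import Data.List.Relation.Unary.All.Properties as All
open import Data.List.Relation.Unary.Any using (here)
import Data.List.Relation.Unary.Any.Properties as Any
open import Data.Nat using (ℕ; suc; _+_; _*_; _≤_)
open import Data.Nat.Properties
open import Algebra.Properties.CommutativeSemigroup +-commutativeSemigroup
  using () renaming (interchange to +-interchange)
open import Data.Product using (Σ; ∃; _×_; _,_; proj₁; proj₂)
open import Data.Sum using (_⊎_; inj₁; inj₂; [_,_]′)
open import Data.Vec using (Vec; []; _∷_; lookup; tabulate)
open import Data.Vec.Properties using (≡-dec; lookup∘tabulate; tabulate∘lookup; tabulate-cong)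
open import Function using (_∘_; _⇔_; mk⇔; Equivalence)
open import Level using (Level)
open import Relation.Binary.Definitions using (DecidableEquality)
open import Relation.Binary.PropositionalEquality
  using (_≡_; refl; sym; trans; cong; cong₂; subst; module ≡-Reasoning)
open import Relation.Nullary.Decidable using (T?; does; proof; dec-true)
open import Relation.Nullary.Reflects using (Reflects; invert)

open Equivalence using (to; from)

private
  variable
    ℓ ℓ′ : Level
    A : Set ℓ
    B : Set ℓ′
    n : ℕ

∧-true⇔ : ∀ {a b} → a ∧ b ≡ true ⇔ (a ≡ true × b ≡ true)
∧-true⇔ {true}  = mk⇔ (refl ,_) proj₂
∧-true⇔ {false} = mk⇔ (λ ()) (λ ())

∧₃-true⇔ : ∀ {a b c} → a ∧ b ∧ c ≡ true ⇔ (a ≡ true × b ≡ true × c ≡ true)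
∧₃-true⇔ {true} {true} = mk⇔ (λ c → refl , refl , c) (λ (_ , _ , c) → c)
∧₃-true⇔ {true} {false} = mk⇔ (λ ()) (λ ())
∧₃-true⇔ {false}        = mk⇔ (λ ()) (λ ())

not-∨-true⇔ : ∀ {a b} → not a ∨ b ≡ true ⇔ (a ≡ true → b ≡ true)
not-∨-true⇔ {true}  = mk⇔ (λ b _ → b) (λ f → f refl)
not-∨-true⇔ {false} = mk⇔ (λ _ ()) (λ _ → refl)

all-allFin⇔ : (p : Fin n → Bool) → all p (allFin n) ≡ true ⇔ (∀ i → p i ≡ true)
all-allFin⇔ {n} p = mk⇔
  (λ h i → to Bool.T-≡ (All.tabulate⁻ (All.all⁺ p (allFin n) (from Bool.T-≡ h)) i))
  (λ h → to Bool.T-≡ (All.all⁻ p (All.tabulate⁺ (λ i → from Bool.T-≡ (h i)))))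

any-allFin⇔ : (p : Fin n → Bool) → any p (allFin n) ≡ true ⇔ ∃ λ i → p i ≡ true
any-allFin⇔ {n} p = mk⇔
  (λ h → let i , pi = Any.tabulate⁻ (Any.any⁻ p (allFin n) (from Bool.T-≡ h)) in i , to Bool.T-≡ pi)
  (λ (i , pi) → to Bool.T-≡ (Any.any⁺ p (Any.tabulate⁺ i (from Bool.T-≡ pi))))

stable-clause⇔ : ∀ {a b c} → not (a ∧ b ∧ c) ≡ true ⇔ (a ≡ true → b ≡ true → c ≡ true → ⊥)
stable-clause⇔ {false}               = mk⇔ (λ _ ()) (λ _ → refl)
stable-clause⇔ {true} {false}        = mk⇔ (λ _ _ ()) (λ _ → refl)
stable-clause⇔ {true} {true} {false} = mk⇔ (λ _ _ _ ()) (λ _ → refl)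
stable-clause⇔ {true} {true} {true}  = mk⇔ (λ ()) (λ f → ⊥-elim (f refl refl refl))

dominated-clause⇔ : ∀ {a b c} → not (a ∧ not b) ∨ c ≡ true ⇔ (a ≡ true → b ≡ false → c ≡ true)
dominated-clause⇔ {false}       = mk⇔ (λ _ ()) (λ _ → refl)
dominated-clause⇔ {true} {true} = mk⇔ (λ _ _ ()) (λ _ → refl)
dominated-clause⇔ {true} {false} = mk⇔ (λ c _ _ → c) (λ f → f refl refl)

record MaximalStable (K : Graph n) (S : Subset n) : Set where
  field
    ⊆V          : ∀ u → lookup S u ≡ true → V K u ≡ true
    independent : ∀ u v → lookup S u ≡ true → lookup S v ≡ true → E K u v ≡ true → ⊥
    dominating  : ∀ v → V K v ≡ true → lookup S v ≡ false →
                  ∃ λ u → lookup S u ≡ true × E K v u ≡ true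

hasNeighbourIn : Graph n → Subset n → Fin n → Bool
hasNeighbourIn {n} K S v = any (λ u → lookup S u ∧ E K v u) (allFin n)

hasNeighbourIn⇔ : ∀ (K : Graph n) S {v} →
                  hasNeighbourIn K S v ≡ true ⇔ ∃ λ u → lookup S u ≡ true × E K v u ≡ true
hasNeighbourIn⇔ K S = mk⇔
  (λ h → let u , su∧e = to (any-allFin⇔ _) h in u , to ∧-true⇔ su∧e)
  (λ (u , su , e) → from (any-allFin⇔ _) (u , from ∧-true⇔ (su , e)))

isMaximalStable⇔ : ∀ (K : Graph n) S → isMaximalStable K S ≡ true ⇔ MaximalStable K S
isMaximalStable⇔ {n} K S = mk⇔ sound complete
  where
  ⊆V-at dominated-at : Fin n → Bool
  ⊆V-at u       = not (lookup S u) ∨ V K u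
  dominated-at v = not (V K v ∧ not (lookup S v)) ∨ hasNeighbourIn K S v
  independent-at : Fin n → Fin n → Bool
  independent-at u v = not (lookup S u ∧ lookup S v ∧ E K u v)

  ⊆V-all independent-all dominated-all : Bool
  ⊆V-all          = all ⊆V-at (allFin n)
  independent-all = all (λ u → all (independent-at u) (allFin n)) (allFin n)
  dominated-all   = all dominated-at (allFin n)

  sound : isMaximalStable K S ≡ true → MaximalStable K S
  sound h = record
    { ⊆V          = λ u → to not-∨-true⇔ (to (all-allFin⇔ ⊆V-at) ⊆V-holds u)
    ; independent = λ u v → to stable-clause⇔
        (to (all-allFin⇔ (independent-at u))
            (to (all-allFin⇔ (λ u → all (independent-at u) (allFin n))) independent-holds u) v)
    ; dominating  = λ v vv sv → to (hasNeighbourIn⇔ K S)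
        (to dominated-clause⇔ (to (all-allFin⇔ dominated-at) dominated-holds v) vv sv)
    }
    where
    stable-holds : ⊆V-all ∧ independent-all ≡ true
    stable-holds = proj₁ (to ∧-true⇔ h)
    dominated-holds : dominated-all ≡ true
    dominated-holds = proj₂ (to (∧-true⇔ {⊆V-all ∧ independent-all}) h)
    ⊆V-holds : ⊆V-all ≡ true
    ⊆V-holds = proj₁ (to ∧-true⇔ stable-holds)
    independent-holds : independent-all ≡ true
    independent-holds = proj₂ (to (∧-true⇔ {⊆V-all}) stable-holds)

  complete : MaximalStable K S → isMaximalStable K S ≡ true
  complete m = from ∧-true⇔ (from ∧-true⇔ (⊆V-holds , independent-holds) , dominated-holds)
    where
    open MaximalStable m
    ⊆V-holds : ⊆V-all ≡ true
    ⊆V-holds = from (all-allFin⇔ ⊆V-at) λ u → from not-∨-true⇔ (⊆V u)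
    independent-holds : independent-all ≡ true
    independent-holds = from (all-allFin⇔ (λ u → all (independent-at u) (allFin n))) λ u →
      from (all-allFin⇔ (independent-at u)) λ v → from stable-clause⇔ (independent u v)
    dominated-holds : dominated-all ≡ true
    dominated-holds = from (all-allFin⇔ dominated-at) λ v → from dominated-clause⇔ λ vv sv →
      from (hasNeighbourIn⇔ K S) (dominating v vv sv)

[_] : Bool → ℕ
[ true ]  = 1
[ false ] = 0

[∧] : ∀ x y → [ x ∧ y ] ≡ [ x ] * [ y ]
[∧] true  b = sym (+-identityʳ [ b ])
[∧] false b = refl

∑ : List A → (A → ℕ) → ℕ
∑ []       f = 0
∑ (x ∷ xs) f = f x + ∑ xs f

∑-cong : ∀ {f g : A → ℕ} (xs : List A) → (∀ x → f x ≡ g x) → ∑ xs f ≡ ∑ xs g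
∑-cong []       f≗g = refl
∑-cong (x ∷ xs) f≗g = cong₂ _+_ (f≗g x) (∑-cong xs f≗g)

∑-++ : (xs ys : List A) (f : A → ℕ) → ∑ (xs ++ ys) f ≡ ∑ xs f + ∑ ys f
∑-++ []       ys f = refl
∑-++ (x ∷ xs) ys f = trans (cong (f x +_) (∑-++ xs ys f)) (sym (+-assoc (f x) _ _))

∑-map : (h : B → A) (xs : List B) (f : A → ℕ) → ∑ (map h xs) f ≡ ∑ xs (f ∘ h)
∑-map h []       f = refl
∑-map h (x ∷ xs) f = cong (f (h x) +_) (∑-map h xs f)

∑-zero : (xs : List A) → ∑ xs (λ _ → 0) ≡ 0
∑-zero []       = refl
∑-zero (x ∷ xs) = ∑-zero xs

∑-+ : (xs : List A) (f g : A → ℕ) → ∑ xs (λ x → f x + g x) ≡ ∑ xs f + ∑ xs g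
∑-+ []       f g = refl
∑-+ (x ∷ xs) f g = trans (cong (f x + g x +_) (∑-+ xs f g))
                         (+-interchange (f x) (g x) (∑ xs f) (∑ xs g))

∑-*ˡ : ∀ c (xs : List A) (f : A → ℕ) → ∑ xs (λ x → c * f x) ≡ c * ∑ xs f
∑-*ˡ c []       f = sym (*-zeroʳ c)
∑-*ˡ c (x ∷ xs) f = trans (cong (c * f x +_) (∑-*ˡ c xs f)) (sym (*-distribˡ-+ c (f x) (∑ xs f)))

∑-comm : (xs : List A) (ys : List B) (F : A → B → ℕ) →
         ∑ xs (λ x → ∑ ys (F x)) ≡ ∑ ys (λ y → ∑ xs (λ x → F x y))
∑-comm []       ys F = sym (∑-zero ys)
∑-comm (x ∷ xs) ys F = trans (cong (∑ ys (F x) +_) (∑-comm xs ys F))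
                             (sym (∑-+ ys (F x) (λ y → ∑ xs (λ x → F x y))))

∑-product : (xs : List A) (ys : List B) (f : A → ℕ) (g : B → ℕ) →
            ∑ xs (λ x → ∑ ys (λ y → f x * g y)) ≡ ∑ xs f * ∑ ys g
∑-product xs ys f g = begin
  ∑ xs (λ x → ∑ ys (λ y → f x * g y)) ≡⟨ ∑-cong xs (λ x → ∑-*ˡ (f x) ys g) ⟩
  ∑ xs (λ x → f x * ∑ ys g)           ≡⟨ ∑-cong xs (λ x → *-comm (f x) (∑ ys g)) ⟩
  ∑ xs (λ x → ∑ ys g * f x)           ≡⟨ ∑-*ˡ (∑ ys g) xs f ⟩
  ∑ ys g * ∑ xs f                     ≡⟨ *-comm (∑ ys g) (∑ xs f) ⟩
  ∑ xs f * ∑ ys g                     ∎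
  where open ≡-Reasoning

length-filterᵇ : (p : A → Bool) (xs : List A) → length (filterᵇ p xs) ≡ ∑ xs (λ x → [ p x ])
length-filterᵇ p []       = refl
length-filterᵇ p (x ∷ xs) with p x
... | true  = cong suc (length-filterᵇ p xs)
... | false = length-filterᵇ p xs

∑-filterᵇ : (p : A → Bool) (xs : List A) (f : A → ℕ) →
            ∑ (filterᵇ p xs) f ≡ ∑ xs (λ x → [ p x ] * f x)
∑-filterᵇ p []       f = refl
∑-filterᵇ p (x ∷ xs) f with p x
... | true  = cong₂ _+_ (sym (+-identityʳ (f x))) (∑-filterᵇ p xs f)
... | false = ∑-filterᵇ p xs f

∑ₛ : (Subset n → ℕ) → ℕ
∑ₛ {n} = ∑ (allSubsets n)

∑ₛ-suc : (f : Subset (suc n) → ℕ) → ∑ₛ f ≡ ∑ₛ (f ∘ (true ∷_)) + ∑ₛ (f ∘ (false ∷_))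
∑ₛ-suc {n} f = trans (∑-++ (map (true ∷_) (allSubsets n)) (map (false ∷_) (allSubsets n)) f)
                     (cong₂ _+_ (∑-map (true ∷_) (allSubsets n) f) (∑-map (false ∷_) (allSubsets n) f))

_≟ₛ_ : DecidableEquality (Subset n)
_≟ₛ_ = ≡-dec Bool._≟_

≟ₛ-true⇔ : ∀ (S T : Subset n) → does (S ≟ₛ T) ≡ true ⇔ S ≡ T
≟ₛ-true⇔ S T = mk⇔ (λ h → invert (subst (Reflects (S ≡ T)) h (proof (S ≟ₛ T))))
                   (dec-true (S ≟ₛ T))

-- Each subset occurs exactly once in allSubsets.
∑ₛ-sift : (T : Subset n) (g : Subset n → ℕ) → ∑ₛ (λ S → [ does (S ≟ₛ T) ] * g S) ≡ g T
∑ₛ-sift [] g = trans (+-identityʳ _) (+-identityʳ (g []))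
∑ₛ-sift {suc n} (true ∷ T) g = begin
  ∑ₛ (λ S → [ does (S ≟ₛ (true ∷ T)) ] * g S)
    ≡⟨ ∑ₛ-suc {n} _ ⟩
  ∑ₛ (λ S → [ does (S ≟ₛ T) ] * g (true ∷ S)) + ∑ₛ {n} (λ _ → 0)
    ≡⟨ cong₂ _+_ (∑ₛ-sift T (g ∘ (true ∷_))) (∑-zero (allSubsets n)) ⟩
  g (true ∷ T) + 0
    ≡⟨ +-identityʳ _ ⟩
  g (true ∷ T)
    ∎
  where open ≡-Reasoning
∑ₛ-sift {suc n} (false ∷ T) g = begin
  ∑ₛ (λ S → [ does (S ≟ₛ (false ∷ T)) ] * g S)
    ≡⟨ ∑ₛ-suc {n} _ ⟩
  ∑ₛ {n} (λ _ → 0) + ∑ₛ (λ S → [ does (S ≟ₛ T) ] * g (false ∷ S))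
    ≡⟨ cong (_+ ∑ₛ (λ S → [ does (S ≟ₛ T) ] * g (false ∷ S))) (∑-zero (allSubsets n)) ⟩
  ∑ₛ (λ S → [ does (S ≟ₛ T) ] * g (false ∷ S))
    ≡⟨ ∑ₛ-sift T (g ∘ (false ∷_)) ⟩
  g (false ∷ T)
    ∎
  where open ≡-Reasoning

record ProductBijection (P Q R : Subset n → Bool) : Set where
  field
    pair        : Subset n → Subset n → Subset n
    fst snd     : Subset n → Subset n
    pair-closed : ∀ A B → Q A ≡ true → R B ≡ true → P (pair A B) ≡ true
    fst-closed  : ∀ I → P I ≡ true → Q (fst I) ≡ true
    snd-closed  : ∀ I → P I ≡ true → R (snd I) ≡ true
    fst-pair    : ∀ A B → Q A ≡ true → R B ≡ true → fst (pair A B) ≡ A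
    snd-pair    : ∀ A B → Q A ≡ true → R B ≡ true → snd (pair A B) ≡ B
    pair-split  : ∀ I → P I ≡ true → pair (fst I) (snd I) ≡ I

module _ {n} {P Q R : Subset n → Bool} (β : ProductBijection P Q R) where
  open ProductBijection β

  private
    Glued : Subset n → Subset n → Subset n → Bool
    Glued I A B = Q A ∧ R B ∧ does (I ≟ₛ pair A B)

    Glued-split : ∀ I A B → Glued I A B ≡ P I ∧ does (A ≟ₛ fst I) ∧ does (B ≟ₛ snd I)
    Glued-split I A B = Bool.⇔→≡ (mk⇔ forward backward)
      where
      forward : Glued I A B ≡ true → P I ∧ does (A ≟ₛ fst I) ∧ does (B ≟ₛ snd I) ≡ true
      forward h with to ∧₃-true⇔ h
      ... | qa , rb , I≟pair with to (≟ₛ-true⇔ I (pair A B)) I≟pair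
      ... | refl = from ∧₃-true⇔ ( pair-closed A B qa rb
                                 , from (≟ₛ-true⇔ A (fst (pair A B))) (sym (fst-pair A B qa rb))
                                 , from (≟ₛ-true⇔ B (snd (pair A B))) (sym (snd-pair A B qa rb)))
      backward : P I ∧ does (A ≟ₛ fst I) ∧ does (B ≟ₛ snd I) ≡ true → Glued I A B ≡ true
      backward h with to ∧₃-true⇔ h
      ... | pi , A≟fst , B≟snd
          with to (≟ₛ-true⇔ A (fst I)) A≟fst | to (≟ₛ-true⇔ B (snd I)) B≟snd
      ... | refl | refl = from ∧₃-true⇔ ( fst-closed I pi
                                        , snd-closed I pi
                                        , from (≟ₛ-true⇔ I (pair (fst I) (snd I))) (sym (pair-split I pi)))

    ∑-Glued-parts : ∀ (g : Subset n → ℕ) A B →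
                    ∑ₛ (λ I → [ Glued I A B ] * g I) ≡ [ Q A ] * [ R B ] * g (pair A B)
    ∑-Glued-parts g A B with Q A | R B
    ... | true  | true  = trans (∑ₛ-sift (pair A B) g) (sym (+-identityʳ (g (pair A B))))
    ... | true  | false = ∑-zero (allSubsets n)
    ... | false | _     = ∑-zero (allSubsets n)

    ∑-Glued-whole : ∀ (g : Subset n → ℕ) I →
                    ∑ₛ (λ A → ∑ₛ (λ B → [ Glued I A B ] * g I)) ≡ [ P I ] * g I
    ∑-Glued-whole g I = begin
      ∑ₛ (λ A → ∑ₛ (λ B → [ Glued I A B ] * g I))
        ≡⟨ ∑-cong (allSubsets n) (λ A → ∑-cong (allSubsets n) (λ B →
             cong (λ b → [ b ] * g I) (Glued-split I A B))) ⟩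
      ∑ₛ (λ A → ∑ₛ (λ B → [ P I ∧ does (A ≟ₛ fst I) ∧ does (B ≟ₛ snd I) ] * g I))
        ≡⟨ ∑-cong (allSubsets n) (λ A → ∑-cong (allSubsets n) (λ B → cong (λ b → [ b ] * g I)
             (sym (Bool.∧-assoc (P I) (does (A ≟ₛ fst I)) (does (B ≟ₛ snd I)))))) ⟩
      ∑ₛ (λ A → ∑ₛ (λ B → [ (P I ∧ does (A ≟ₛ fst I)) ∧ does (B ≟ₛ snd I) ] * g I))
        ≡⟨ ∑-cong (allSubsets n) (λ A → inner (P I ∧ does (A ≟ₛ fst I))) ⟩
      ∑ₛ (λ A → [ P I ∧ does (A ≟ₛ fst I) ] * g I)
        ≡⟨ inner (P I) ⟩
      [ P I ] * g I
        ∎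
      where
      open ≡-Reasoning
      inner : ∀ a {T : Subset n} → ∑ₛ (λ S → [ a ∧ does (S ≟ₛ T) ] * g I) ≡ [ a ] * g I
      inner true  {T} = trans (∑ₛ-sift T (λ _ → g I)) (sym (+-identityʳ (g I)))
      inner false     = ∑-zero (allSubsets n)

  -- Both sides count the triples (I , A , B) with I = pair A B, summed in different orders.
  ∑ₛ-reindex : ∀ (g : Subset n → ℕ) →
               ∑ₛ (λ I → [ P I ] * g I) ≡ ∑ₛ (λ A → ∑ₛ (λ B → [ Q A ] * [ R B ] * g (pair A B)))
  ∑ₛ-reindex g = begin
    ∑ₛ (λ I → [ P I ] * g I)
      ≡⟨ ∑-cong (allSubsets n) (λ I → sym (∑-Glued-whole g I)) ⟩
    ∑ₛ (λ I → ∑ₛ (λ A → ∑ₛ (λ B → [ Glued I A B ] * g I)))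
      ≡⟨ ∑-comm (allSubsets n) (allSubsets n) _ ⟩
    ∑ₛ (λ A → ∑ₛ (λ I → ∑ₛ (λ B → [ Glued I A B ] * g I)))
      ≡⟨ ∑-cong (allSubsets n) (λ A → ∑-comm (allSubsets n) (allSubsets n) _) ⟩
    ∑ₛ (λ A → ∑ₛ (λ B → ∑ₛ (λ I → [ Glued I A B ] * g I)))
      ≡⟨ ∑-cong (allSubsets n) (λ A → ∑-cong (allSubsets n) (∑-Glued-parts g A)) ⟩
    ∑ₛ (λ A → ∑ₛ (λ B → [ Q A ] * [ R B ] * g (pair A B)))
      ∎
    where open ≡-Reasoning

  ∑ₛ-product : (w wQ wR : Subset n → ℕ) →
               (∀ A B → Q A ≡ true → R B ≡ true → w (pair A B) ≡ wQ A * wR B) →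
               ∑ₛ (λ I → [ P I ] * w I) ≡ ∑ₛ (λ A → [ Q A ] * wQ A) * ∑ₛ (λ B → [ R B ] * wR B)
  ∑ₛ-product w wQ wR w-pair = begin
    ∑ₛ (λ I → [ P I ] * w I)
      ≡⟨ ∑ₛ-reindex w ⟩
    ∑ₛ (λ A → ∑ₛ (λ B → [ Q A ] * [ R B ] * w (pair A B)))
      ≡⟨ ∑-cong (allSubsets n) (λ A → ∑-cong (allSubsets n) (factorise A)) ⟩
    ∑ₛ (λ A → ∑ₛ (λ B → [ Q A ] * wQ A * ([ R B ] * wR B)))
      ≡⟨ ∑-product (allSubsets n) (allSubsets n) _ _ ⟩
    ∑ₛ (λ A → [ Q A ] * wQ A) * ∑ₛ (λ B → [ R B ] * wR B)
      ∎
    where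
    open ≡-Reasoning
    factorise : ∀ A B → [ Q A ] * [ R B ] * w (pair A B) ≡ [ Q A ] * wQ A * ([ R B ] * wR B)
    factorise A B with Q A in qa | R B in rb
    ... | true  | true  = trans (*-identityˡ _) (trans (w-pair A B qa rb)
                            (sym (cong₂ _*_ (*-identityˡ (wQ A)) (*-identityˡ (wR B)))))
    ... | true  | false = sym (*-zeroʳ (1 * wQ A))
    ... | false | _     = refl

lookup-ext : ∀ {xs ys : Vec A n} → (∀ i → lookup xs i ≡ lookup ys i) → xs ≡ ys
lookup-ext {xs = xs} {ys} eq =
  trans (sym (tabulate∘lookup xs)) (trans (tabulate-cong eq) (tabulate∘lookup ys))

length≡1⇒∈-unique : ∀ {xs : List A} {x y} → length xs ≡ 1 → x ∈ xs → y ∈ xs → x ≡ y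
length≡1⇒∈-unique {xs = _ ∷ []} refl (here refl) (here refl) = refl

module _ (K : Graph n) where

  E-Vʳ : ∀ u v → E K u v ≡ true → V K v ≡ true
  E-Vʳ u v e = E-V K v u (trans (E-sym K v u) e)

  pendant-unique : ∀ {w y z} → Pendant K w → E K w y ≡ true → E K w z ≡ true → y ≡ z
  pendant-unique {w} pendant wy wz = length≡1⇒∈-unique pendant (neighbour wy) (neighbour wz)
    where
    neighbour : ∀ {u} → E K w u ≡ true → u ∈ filterᵇ (E K w) (allFin n)
    neighbour {u} e = ∈-filter⁺ (T? ∘ E K w) (∈-allFin u) (from Bool.T-≡ e)

glueAt : (inP inQ a b : Bool) → Bool
glueAt true  true  a b = a ∧ b
glueAt true  false a b = a
glueAt false true  a b = b
glueAt false false a b = false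

glue : (P Q : Graph n) → Subset n → Subset n → Subset n
glue P Q A B = tabulate λ v → glueAt (V P v) (V Q v) (lookup A v) (lookup B v)

-- A shared vertex that I dominates only through Q must be in the P-part for it to be maximal.
restrict : (P Q : Graph n) → Subset n → Subset n
restrict P Q I = tabulate λ v →
  if V P v then (if V Q v then not (hasNeighbourIn P I v) else lookup I v) else false

module _ (P Q : Graph n) (A B : Subset n) {v : Fin n} where

  lookup-glue : lookup (glue P Q A B) v ≡ glueAt (V P v) (V Q v) (lookup A v) (lookup B v)
  lookup-glue = lookup∘tabulate _ v

  glue-outside : V P v ≡ false → V Q v ≡ false → lookup (glue P Q A B) v ≡ false
  glue-outside pv qv rewrite lookup-glue | pv | qv = refl

  glue-private : V P v ≡ true → V Q v ≡ false → lookup (glue P Q A B) v ≡ lookup A v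
  glue-private pv qv rewrite lookup-glue | pv | qv = refl

  glue-shared : V P v ≡ true → V Q v ≡ true → lookup (glue P Q A B) v ≡ lookup A v ∧ lookup B v
  glue-shared pv qv rewrite lookup-glue | pv | qv = refl

module _ (P Q : Graph n) (I : Subset n) {v : Fin n} where

  lookup-restrict : lookup (restrict P Q I) v ≡
    (if V P v then (if V Q v then not (hasNeighbourIn P I v) else lookup I v) else false)
  lookup-restrict = lookup∘tabulate _ v

  restrict-outside : V P v ≡ false → lookup (restrict P Q I) v ≡ false
  restrict-outside pv rewrite lookup-restrict | pv = refl

  restrict-private : V P v ≡ true → V Q v ≡ false → lookup (restrict P Q I) v ≡ lookup I v
  restrict-private pv qv rewrite lookup-restrict | pv | qv = refl

  restrict-shared : V P v ≡ true → V Q v ≡ true →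
                    lookup (restrict P Q I) v ≡ not (hasNeighbourIn P I v)
  restrict-shared pv qv rewrite lookup-restrict | pv | qv = refl

glue-∈ˡ : ∀ (P Q : Graph n) A B {u} →
          lookup (glue P Q A B) u ≡ true → V P u ≡ true → lookup A u ≡ true
glue-∈ˡ P Q A B {u} gu pu with V Q u in qu
... | false = trans (sym (glue-private P Q A B pu qu)) gu
... | true  = proj₁ (to ∧-true⇔ (trans (sym (glue-shared P Q A B pu qu)) gu))

glue-∉ : ∀ (P Q : Graph n) A B {v} → V P v ∨ V Q v ≡ true → lookup (glue P Q A B) v ≡ false →
         (V P v ≡ true × lookup A v ≡ false) ⊎ (V Q v ≡ true × lookup B v ≡ false)
glue-∉ P Q A B {v} pq gv rewrite lookup-glue P Q A B {v} with V P v | V Q v | lookup A v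
... | true  | _     | false = inj₁ (refl , refl)
... | true  | true  | true  = inj₂ (refl , gv)
... | false | true  | _     = inj₂ (refl , gv)

glue-comm : (P Q : Graph n) (A B : Subset n) → glue Q P B A ≡ glue P Q A B
glue-comm P Q A B = tabulate-cong λ v → glueAt-comm (V P v) (V Q v) (lookup A v) (lookup B v)
  where
  glueAt-comm : ∀ p q a b → glueAt q p b a ≡ glueAt p q a b
  glueAt-comm true  true  a b = Bool.∧-comm b a
  glueAt-comm true  false a b = refl
  glueAt-comm false true  a b = refl
  glueAt-comm false false a b = refl

∨-true⇒ : ∀ {a b} → a ∨ b ≡ true → a ≡ true ⊎ b ≡ true
∨-true⇒ {true}  _ = inj₁ refl
∨-true⇒ {false} h = inj₂ h

isDecomposition-swap : ∀ {G P Q : Graph n} → IsDecomposition G P Q → IsDecomposition G Q P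
isDecomposition-swap {G = G} {P} {Q} dec = record
  { V-union    = λ v → trans (V-union v) (Bool.∨-comm (V P v) (V Q v))
  ; E-union    = λ u v → trans (E-union u v) (Bool.∨-comm (E P u v) (E Q u v))
  ; E-disjoint = λ u v → trans (Bool.∧-comm (E Q u v) (E P u v)) (E-disjoint u v)
  }
  where open IsDecomposition dec

module _ {G P Q : Graph n} (dec : IsDecomposition G P Q) where
  open IsDecomposition dec

  E-⊆ˡ : ∀ u v → E P u v ≡ true → E G u v ≡ true
  E-⊆ˡ u v e rewrite E-union u v | e = refl

  V-⊆ˡ : ∀ v → V P v ≡ true → V G v ≡ true
  V-⊆ˡ v pv rewrite V-union v | pv = refl

  E-split : ∀ u v → E G u v ≡ true → E P u v ≡ true ⊎ E Q u v ≡ true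
  E-split u v e = ∨-true⇒ (trans (sym (E-union u v)) e)

module _ {K : Graph n} {S : Subset n} (m : MaximalStable K S) where
  open MaximalStable m

  ∉V⇒∉ : ∀ v → V K v ≡ false → lookup S v ≡ false
  ∉V⇒∉ v kv with lookup S v in sv
  ... | false = refl
  ... | true with () ← trans (sym kv) (⊆V v sv)

  -- The only G-neighbour of w is v ∉ S, so nothing in S can dominate w.
  pendant-∈ : ∀ {G : Graph n} {v w} → (∀ a b → E K a b ≡ true → E G a b ≡ true) →
              Pendant G w → E G w v ≡ true → V K w ≡ true → lookup S v ≡ false → lookup S w ≡ true
  pendant-∈ {G = G} {v} {w} K⊆G pendant wv kw sv with lookup S w in sw
  ... | true  = refl
  ... | false with dominating w kw sw
  ...   | u , su , wu with pendant-unique G pendant (K⊆G w u wu) wv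
  ...     | refl with () ← trans (sym sv) su

#maximalStable : Graph n → ℕ
#maximalStable K = length (maximalStableSets K)

#maximalStable∋ : Graph n → Fin n → ℕ
#maximalStable∋ K x = length (filterᵇ (λ S → lookup S x) (maximalStableSets K))

#maximalStable≡∑ₛ : ∀ (K : Graph n) → #maximalStable K ≡ ∑ₛ (λ S → [ isMaximalStable K S ] * 1)
#maximalStable≡∑ₛ {n} K = trans (length-filterᵇ (isMaximalStable K) (allSubsets n))
                               (∑-cong (allSubsets n) (λ S → sym (*-identityʳ _)))

#maximalStable∋≡∑ₛ : ∀ (K : Graph n) x →
                     #maximalStable∋ K x ≡ ∑ₛ (λ S → [ isMaximalStable K S ] * [ lookup S x ])
#maximalStable∋≡∑ₛ {n} K x = trans (length-filterᵇ (λ S → lookup S x) (maximalStableSets K))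
                                  (∑-filterᵇ (isMaximalStable K) (allSubsets n) (λ S → [ lookup S x ]))

#maximalStable∋≤#maximalStable : ∀ (K : Graph n) x → #maximalStable∋ K x ≤ #maximalStable K
#maximalStable∋≤#maximalStable K x = length-filter (T? ∘ (λ S → lookup S x)) (maximalStableSets K)

Shared : (P Q : Graph n) → Fin n → Set
Shared P Q v = V P v ≡ true × V Q v ≡ true

record TwoLayeredDecomposition (G P Q : Graph n) : Set where
  field
    isDecomposition    : IsDecomposition G P Q
    shared-independent : ∀ u v → Shared P Q u → Shared P Q v → E G u v ≡ true → ⊥
    shared-twoLayered  : ∀ v → Shared P Q v → TwoLayered G v

twoLayeredDecomposition-swap : ∀ {G P Q : Graph n} →
                               TwoLayeredDecomposition G P Q → TwoLayeredDecomposition G Q P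
twoLayeredDecomposition-swap D = record
  { isDecomposition    = isDecomposition-swap isDecomposition
  ; shared-independent = λ u v (qu , pu) (qv , pv) → shared-independent u v (pu , qu) (pv , qv)
  ; shared-twoLayered  = λ v (qv , pv) → shared-twoLayered v (pv , qv)
  }
  where open TwoLayeredDecomposition D

module Side {G P Q : Graph n} (D : TwoLayeredDecomposition G P Q) where
  open TwoLayeredDecomposition D
  open MaximalStable

  private
    dec : IsDecomposition G P Q
    dec = isDecomposition

  shared-neighbour-private : ∀ {u v} → Shared P Q v → E P v u ≡ true → V Q u ≡ false
  shared-neighbour-private {u} {v} sv vu with V Q u in qu
  ... | false = refl
  ... | true  = ⊥-elim (shared-independent v u sv (E-Vʳ P v u vu , qu) (E-⊆ˡ dec v u vu))

  private-edge : ∀ {u v} → V Q v ≡ false → E G v u ≡ true → E P v u ≡ true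
  private-edge {u} {v} qv vu with E-split dec v u vu
  ... | inj₁ pvu = pvu
  ... | inj₂ qvu with () ← trans (sym qv) (E-V Q v u qvu)

  module _ {A B : Subset n} (mA : MaximalStable P A) (mB : MaximalStable Q B) where

    -- v is private to P (shared vertices are non-adjacent); the pendant neighbour w of v that
    -- u's 2-layeredness provides lies in A, and also in B when w is shared.
    dominated-via-pendant : ∀ {u v} → Shared P Q u → E P u v ≡ true → lookup A v ≡ false →
                            ∃ λ w → lookup (glue P Q A B) w ≡ true × E G v w ≡ true
    dominated-via-pendant {u} {v} (pu , qu) uv av
      with shared-twoLayered u (pu , qu) v (E-⊆ˡ dec u v uv)
    ... | w , vw , pendant = w , glue-w , vw
      where
      qv : V Q v ≡ false
      qv = shared-neighbour-private (pu , qu) uv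
      wv : E G w v ≡ true
      wv = trans (E-sym G w v) vw
      pw : V P w ≡ true
      pw = E-Vʳ P v w (private-edge qv vw)
      aw : lookup A w ≡ true
      aw = pendant-∈ mA {G = G} (E-⊆ˡ dec) pendant wv pw av
      glue-w : lookup (glue P Q A B) w ≡ true
      glue-w with V Q w in qw
      ... | false = trans (glue-private P Q A B pw qw) aw
      ... | true  = trans (glue-shared P Q A B pw qw)
                          (cong₂ _∧_ aw (pendant-∈ mB {G = G} (E-⊆ˡ (isDecomposition-swap dec))
                                                   pendant wv qw (∉V⇒∉ mB v qv)))

    ∉-dominated-by-glue : ∀ v → V P v ≡ true → lookup A v ≡ false →
                          ∃ λ u → lookup (glue P Q A B) u ≡ true × E G v u ≡ true
    ∉-dominated-by-glue v pv av with dominating mA v pv av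
    ... | u , au , vu with V Q u in qu
    ...   | false = u , trans (glue-private P Q A B (E-Vʳ P v u vu) qu) au , E-⊆ˡ dec v u vu
    ...   | true  = dominated-via-pendant (E-Vʳ P v u vu , qu) (trans (E-sym P u v) vu) av

    restrict-glue : restrict P Q (glue P Q A B) ≡ A
    restrict-glue = lookup-ext restrict-glue-at
      where
      S : Subset n
      S = glue P Q A B

      shared-at : ∀ v → Shared P Q v → not (hasNeighbourIn P S v) ≡ lookup A v
      shared-at v sv@(pv , _) with lookup A v in av
      ... | false with dominating mA v pv av
      ...   | u , au , vu = cong not (from (hasNeighbourIn⇔ P S) (u , su , vu))
        where
        su : lookup S u ≡ true
        su = trans (glue-private P Q A B (E-Vʳ P v u vu) (shared-neighbour-private sv vu)) au
      shared-at v sv | true with hasNeighbourIn P S v in has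
      ...   | false = refl
      ...   | true with to (hasNeighbourIn⇔ P S) has
      ...     | u , su , vu =
        ⊥-elim (independent mA v u av (glue-∈ˡ P Q A B su (E-Vʳ P v u vu)) vu)

      restrict-glue-at : ∀ v → lookup (restrict P Q S) v ≡ lookup A v
      restrict-glue-at v with V P v in pv | V Q v in qv
      ... | false | _     = trans (restrict-outside P Q S pv) (sym (∉V⇒∉ mA v pv))
      ... | true  | false = trans (restrict-private P Q S pv qv) (glue-private P Q A B pv qv)
      ... | true  | true  = trans (restrict-shared P Q S pv qv) (shared-at v (pv , qv))

  module _ {I : Subset n} (mI : MaximalStable G I) where

    private
      R : Subset n
      R = restrict P Q I

    ∈⇒no-neighbour : ∀ {v} → lookup I v ≡ true → hasNeighbourIn P I v ≡ false
    ∈⇒no-neighbour {v} iv with hasNeighbourIn P I v in has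
    ... | false = refl
    ... | true with to (hasNeighbourIn⇔ P I) has
    ...   | u , iu , vu = ⊥-elim (independent mI v u iv iu (E-⊆ˡ dec v u vu))

    restrict-⊆V : ∀ v → lookup R v ≡ true → V P v ≡ true
    restrict-⊆V v rv with V P v in pv
    ... | true = refl
    ... | false with () ← trans (sym (restrict-outside P Q I pv)) rv

    shared-∈restrict-isolated : ∀ {u v} → Shared P Q v → lookup R v ≡ true →
                                lookup I u ≡ true → E P v u ≡ true → ⊥
    shared-∈restrict-isolated {u} {v} (pv , qv) rv iu vu
      with () ← trans (sym (cong not (from (hasNeighbourIn⇔ P I) (u , iu , vu))))
                      (trans (sym (restrict-shared P Q I pv qv)) rv)

    ∈⇒∈restrict : ∀ {u} → V P u ≡ true → lookup I u ≡ true → lookup R u ≡ true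
    ∈⇒∈restrict {u} pu iu with V Q u in qu
    ... | false = trans (restrict-private P Q I pu qu) iu
    ... | true  = trans (restrict-shared P Q I pu qu) (cong not (∈⇒no-neighbour iu))

    private-∈restrict⇒∈ : ∀ {v} → V Q v ≡ false → lookup R v ≡ true → lookup I v ≡ true
    private-∈restrict⇒∈ {v} qv rv = trans (sym (restrict-private P Q I (restrict-⊆V v rv) qv)) rv

    restrict-independent : ∀ u v → lookup R u ≡ true → lookup R v ≡ true → E P u v ≡ true → ⊥
    restrict-independent u v ru rv uv with V Q u in qu | V Q v in qv
    ... | true  | true  = shared-independent u v (restrict-⊆V u ru , qu) (restrict-⊆V v rv , qv)
                                             (E-⊆ˡ dec u v uv)
    ... | true  | false = shared-∈restrict-isolated (restrict-⊆V u ru , qu) ru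
                                                   (private-∈restrict⇒∈ qv rv) uv
    ... | false | true  = shared-∈restrict-isolated (restrict-⊆V v rv , qv) rv
                                                   (private-∈restrict⇒∈ qu ru)
                                                   (trans (E-sym P v u) uv)
    ... | false | false = independent mI u v (private-∈restrict⇒∈ qu ru)
                                             (private-∈restrict⇒∈ qv rv)
                                             (E-⊆ˡ dec u v uv)

    restrict-dominating : ∀ v → V P v ≡ true → lookup R v ≡ false →
                          ∃ λ u → lookup R u ≡ true × E P v u ≡ true
    restrict-dominating v pv rv with V Q v in qv
    ... | true with to (hasNeighbourIn⇔ P I)
                       (Bool.not-injective (trans (sym (restrict-shared P Q I pv qv)) rv))
    ...   | u , iu , vu = u , ∈⇒∈restrict (E-Vʳ P v u vu) iu , vu
    restrict-dominating v pv rv | false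
      with dominating mI v (V-⊆ˡ dec v pv) (trans (sym (restrict-private P Q I pv qv)) rv)
    ...   | u , iu , vu = u , ∈⇒∈restrict (E-Vʳ P v u (private-edge qv vu)) iu , private-edge qv vu

    restrict-maximalStable : MaximalStable P R
    restrict-maximalStable = record
      { ⊆V          = restrict-⊆V
      ; independent = restrict-independent
      ; dominating  = restrict-dominating
      }

module _ {G C H : Graph n} (D : TwoLayeredDecomposition G C H) where
  open TwoLayeredDecomposition D
  open MaximalStable
  open IsDecomposition using (V-union)

  private
    dec : IsDecomposition G C H
    dec = isDecomposition
    module L = Side D
    module R = Side (twoLayeredDecomposition-swap D)

  lookup-glue-comm : ∀ A B v → lookup (glue C H A B) v ≡ lookup (glue H C B A) v
  lookup-glue-comm A B v = cong (λ S → lookup S v) (sym (glue-comm C H A B))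

  glue-maximalStable : ∀ {A B} → MaximalStable C A → MaximalStable H B → MaximalStable G (glue C H A B)
  glue-maximalStable {A} {B} mA mB = record
    { ⊆V          = glue-⊆V
    ; independent = glue-independent
    ; dominating  = glue-dominating
    }
    where
    S : Subset n
    S = glue C H A B

    glue-∈ʳ : ∀ {u} → lookup S u ≡ true → V H u ≡ true → lookup B u ≡ true
    glue-∈ʳ {u} su hu = glue-∈ˡ H C B A (trans (sym (lookup-glue-comm A B u)) su) hu

    glue-⊆V : ∀ v → lookup S v ≡ true → V G v ≡ true
    glue-⊆V v sv with V C v in cv | V H v in hv
    ... | true  | _     = V-⊆ˡ dec v cv
    ... | false | true  = V-⊆ˡ (isDecomposition-swap dec) v hv
    ... | false | false with () ← trans (sym (glue-outside C H A B cv hv)) sv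

    glue-independent : ∀ u v → lookup S u ≡ true → lookup S v ≡ true → E G u v ≡ true → ⊥
    glue-independent u v su sv uv with E-split dec u v uv
    ... | inj₁ cuv = independent mA u v (glue-∈ˡ C H A B su (E-V C u v cuv))
                                        (glue-∈ˡ C H A B sv (E-Vʳ C u v cuv)) cuv
    ... | inj₂ huv = independent mB u v (glue-∈ʳ su (E-V H u v huv))
                                        (glue-∈ʳ sv (E-Vʳ H u v huv)) huv

    glue-dominating : ∀ v → V G v ≡ true → lookup S v ≡ false →
                      ∃ λ u → lookup S u ≡ true × E G v u ≡ true
    glue-dominating v gv sv
      with glue-∉ C H A B (trans (sym (V-union dec v)) gv) sv
    ... | inj₁ (cv , av) = L.∉-dominated-by-glue mA mB v cv av
    ... | inj₂ (hv , bv) with R.∉-dominated-by-glue mB mA v hv bv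
    ...   | u , su , vu = u , trans (lookup-glue-comm A B u) su , vu

  glue-restrict : ∀ {I} → MaximalStable G I → glue C H (restrict C H I) (restrict H C I) ≡ I
  glue-restrict {I} mI = lookup-ext glue-restrict-at
    where
    shared-at : ∀ v → V G v ≡ true →
                not (hasNeighbourIn C I v) ∧ not (hasNeighbourIn H I v) ≡ lookup I v
    shared-at v gv with lookup I v in iv
    ... | true rewrite L.∈⇒no-neighbour mI iv | R.∈⇒no-neighbour mI iv = refl
    ... | false with dominating mI v gv iv
    ...   | u , iu , vu with E-split dec v u vu
    ...     | inj₁ cvu rewrite from (hasNeighbourIn⇔ C I) (u , iu , cvu) = refl
    ...     | inj₂ hvu rewrite from (hasNeighbourIn⇔ H I) (u , iu , hvu) =
                Bool.∧-zeroʳ (not (hasNeighbourIn C I v))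

    Iᶜ Iʰ : Subset n
    Iᶜ = restrict C H I
    Iʰ = restrict H C I

    glue-restrict-at : ∀ v → lookup (glue C H Iᶜ Iʰ) v ≡ lookup I v
    glue-restrict-at v with V C v in cv | V H v in hv
    ... | true  | false = trans (glue-private C H Iᶜ Iʰ cv hv) (restrict-private C H I cv hv)
    ... | false | true  = trans (lookup-glue-comm Iᶜ Iʰ v)
                                (trans (glue-private H C Iʰ Iᶜ hv cv) (restrict-private H C I hv cv))
    ... | true  | true  = trans (glue-shared C H Iᶜ Iʰ cv hv)
                                (trans (cong₂ _∧_ (restrict-shared C H I cv hv)
                                                  (restrict-shared H C I hv cv))
                                       (shared-at v (V-⊆ˡ dec v cv)))
    ... | false | false = trans (glue-outside C H Iᶜ Iʰ cv hv)
                                (sym (∉V⇒∉ mI v (trans (V-union dec v) (cong₂ _∨_ cv hv))))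

  maximalStable-productBijection :
    ProductBijection (isMaximalStable G) (isMaximalStable C) (isMaximalStable H)
  maximalStable-productBijection = record
    { pair        = glue C H
    ; fst         = restrict C H
    ; snd         = restrict H C
    ; pair-closed = λ A B ca hb →
        from (isMaximalStable⇔ G (glue C H A B)) (glue-maximalStable (ms C A ca) (ms H B hb))
    ; fst-closed  = λ I gi →
        from (isMaximalStable⇔ C (restrict C H I)) (L.restrict-maximalStable (ms G I gi))
    ; snd-closed  = λ I gi →
        from (isMaximalStable⇔ H (restrict H C I)) (R.restrict-maximalStable (ms G I gi))
    ; fst-pair    = λ A B ca hb → L.restrict-glue (ms C A ca) (ms H B hb)
    ; snd-pair    = λ A B ca hb → trans (cong (restrict H C) (sym (glue-comm C H A B)))
                                        (R.restrict-glue (ms H B hb) (ms C A ca))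
    ; pair-split  = λ I gi → glue-restrict (ms G I gi)
    }
    where
    ms : ∀ K S → isMaximalStable K S ≡ true → MaximalStable K S
    ms K S = to (isMaximalStable⇔ K S)

  private
    β : ProductBijection (isMaximalStable G) (isMaximalStable C) (isMaximalStable H)
    β = maximalStable-productBijection

  #maximalStable-product : #maximalStable G ≡ #maximalStable C * #maximalStable H
  #maximalStable-product = begin
    #maximalStable G
      ≡⟨ #maximalStable≡∑ₛ G ⟩
    ∑ₛ (λ I → [ isMaximalStable G I ] * 1)
      ≡⟨ ∑ₛ-product β (λ _ → 1) (λ _ → 1) (λ _ → 1) (λ _ _ _ _ → refl) ⟩
    ∑ₛ (λ A → [ isMaximalStable C A ] * 1) * ∑ₛ (λ B → [ isMaximalStable H B ] * 1)
      ≡⟨ sym (cong₂ _*_ (#maximalStable≡∑ₛ C) (#maximalStable≡∑ₛ H)) ⟩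
    #maximalStable C * #maximalStable H
      ∎
    where open ≡-Reasoning

  #maximalStable∋-product-private : ∀ {x} → V C x ≡ true → V H x ≡ false →
                                 #maximalStable∋ G x ≡ #maximalStable∋ C x * #maximalStable H
  #maximalStable∋-product-private {x} cx hx = begin
    #maximalStable∋ G x
      ≡⟨ #maximalStable∋≡∑ₛ G x ⟩
    ∑ₛ (λ I → [ isMaximalStable G I ] * [ lookup I x ])
      ≡⟨ ∑ₛ-product β _ (λ A → [ lookup A x ]) (λ _ → 1) (λ A B _ _ →
           trans (cong [_] (glue-private C H A B cx hx)) (sym (*-identityʳ _))) ⟩
    ∑ₛ (λ A → [ isMaximalStable C A ] * [ lookup A x ]) *
    ∑ₛ (λ B → [ isMaximalStable H B ] * 1)
      ≡⟨ sym (cong₂ _*_ (#maximalStable∋≡∑ₛ C x) (#maximalStable≡∑ₛ H)) ⟩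
    #maximalStable∋ C x * #maximalStable H
      ∎
    where open ≡-Reasoning

  #maximalStable∋-product-shared : ∀ {x} → Shared C H x →
                                #maximalStable∋ G x ≡ #maximalStable∋ C x * #maximalStable∋ H x
  #maximalStable∋-product-shared {x} (cx , hx) = begin
    #maximalStable∋ G x
      ≡⟨ #maximalStable∋≡∑ₛ G x ⟩
    ∑ₛ (λ I → [ isMaximalStable G I ] * [ lookup I x ])
      ≡⟨ ∑ₛ-product β _ (λ A → [ lookup A x ]) (λ B → [ lookup B x ]) (λ A B _ _ →
           trans (cong [_] (glue-shared C H A B cx hx)) ([∧] (lookup A x) (lookup B x))) ⟩
    ∑ₛ (λ A → [ isMaximalStable C A ] * [ lookup A x ]) *
    ∑ₛ (λ B → [ isMaximalStable H B ] * [ lookup B x ])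
      ≡⟨ sym (cong₂ _*_ (#maximalStable∋≡∑ₛ C x) (#maximalStable∋≡∑ₛ H x)) ⟩
    #maximalStable∋ C x * #maximalStable∋ H x
      ∎
    where open ≡-Reasoning

  rare-lift : ∀ {x} → Rare C x → Rare G x
  rare-lift {x} (cx , rare) = V-⊆ˡ dec x cx , bound
    where
    twice-*-mono-≤ : ∀ {a b c d} → 2 * a ≤ c → b ≤ d → 2 * (a * b) ≤ c * d
    twice-*-mono-≤ {a} {b} {c} {d} 2a≤c b≤d =
      subst (_≤ c * d) (*-assoc 2 a b) (*-mono-≤ 2a≤c b≤d)

    bound : 2 * #maximalStable∋ G x ≤ #maximalStable G
    bound with V H x in hx
    ... | false rewrite #maximalStable∋-product-private cx hx | #maximalStable-product =
      twice-*-mono-≤ {#maximalStable∋ C x} {#maximalStable H} rare ≤-refl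
    ... | true  rewrite #maximalStable∋-product-shared (cx , hx) | #maximalStable-product =
      twice-*-mono-≤ {#maximalStable∋ C x} {#maximalStable∋ H x} rare
                     (#maximalStable∋≤#maximalStable H x)

theorem3p2 : {n : ℕ} (G C H : Graph n) → Bipartite G → IsDecomposition G C H
    → (Σ (Fin n → Bool) λ c → IsBipartition G c × (Σ Bool λ b → ∀ v → V C v ≡ true → V H v ≡ true → c v ≡ b))
    → (∀ v → V C v ≡ true → V H v ≡ true → TwoLayered G v)
    → ∀ x → (Rare C x ⊎ Rare H x) → Rare G x
theorem3p2 G C H _ dec (c , bipartition , b , same-class) twoLayered x =
  [ rare-lift D , rare-lift (twoLayeredDecomposition-swap D) ]′
  where
  D : TwoLayeredDecomposition G C H
  D = record
    { isDecomposition    = dec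
    ; shared-independent = λ u v (cu , hu) (cv , hv) uv →
        bipartition u v uv (trans (same-class u cu hu) (sym (same-class v cv hv)))
    ; shared-twoLayered  = λ v (cv , hv) → twoLayered v cv hv
    }
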